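{- Let $(p_x,p'_x)$ and $(p_y,p'_y)$ be pairs of positive integers with $|p_x-p'_x|=|p_y-p'_y|=1$, let $Z$ be a finite word over $\{a,b\}$, and let $X=\alpha_{(p_x,p'_x)}(Y)$ with $Y=\alpha_{(p_y,p'_y)}(Z)$ be a finite Sturmian word. Then the total number of occurrences of maximal original palindromes in $X$ is $$2(p_x-1)\big(|Z|_a\,p_y + |Z|_b\,p'_y\big) + 2|Z|\,p'_x.$$
   Context: Words are over the alphabet $\{a,b\}$; $|W|$ is the length of $W$ and $|W|_l$ the number of occurrences of the letter $l$. A Sturmian word is a right-infinite aperiodic word over $\{a,b\}$ of minimal factor complexity; a finite Sturmian word is a finite factor of one. For positive integers $p,p'$ with $|p-p'|=1$, $\alpha_{(p,p')}$ is the morphism $a\mapsto a^pb$, $b\mapsto a^{p'}b$. A palindrome is a word equal to its reverse; its center is its middle letter if its length is odd and its two middle letters (necessarily $aa$) if even. Every occurrence of $a$, $b$ or $aa$ in a word is the center of exactly one maximal palindrome occurrence (the longest palindromic factor centered there); these are the maximal palindrome occurrences. Original/reflection: for a maximal palindrome occurrence in $X=\alpha(Y)$ with center occurrence $c\in\{a,b,aa\}$, $X=x_1cx_2$, it is a reflection if there is a factorization $Y=t_1\,l\,t_2$ with $l\in\{a,b,aa\}$ such that $\alpha(l)=ucv$, $x_1=\alpha(t_1)u$, $x_2=v\alpha(t_2)$ and this occurrence of $c$ is the center of the palindrome $b\alpha(l)=b\,u\,c\,v$ (i.e. $|bu|=|v|$); otherwise it is original. -}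

module Defs where

open import Data.Nat using (ℕ; zero; suc; _+_; _*_; _∸_; _≤_; _<_; _/_; _%_)
open import Data.List using (List; []; _∷_; _++_; length; take; drop; reverse; map; replicate; concatMap; upTo)
open import Data.Product using (Σ; ∃; ∃-syntax; _×_; _,_)
open import Data.Sum using (_⊎_)
open import Relation.Binary.PropositionalEquality using (_≡_)
open import Relation.Nullary using (¬_)
open import Function.Bundles using (_⇔_)
open import Data.List.Membership.Propositional using (_∈_)
open import Data.List.Relation.Unary.Unique.Propositional using (Unique)

data Letter : Set where
  a b : Letter

Word : Set
Word = List Letter

count : Letter → Word → ℕ
count l [] = 0
count a (a ∷ w) = suc (count a w)
count a (b ∷ w) = count a w
count b (a ∷ w) = count b w
count b (b ∷ w) = suc (count b w)

ValidPair : ℕ → ℕ → Set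
ValidPair p p' = 1 ≤ p × 1 ≤ p' × (p' ≡ suc p ⊎ p ≡ suc p')

αimg : ℕ → ℕ → Letter → Word
αimg p p' a = replicate p a ++ (b ∷ [])
αimg p p' b = replicate p' a ++ (b ∷ [])

α : ℕ → ℕ → Word → Word
α p p' = concatMap (αimg p p')

InfWord : Set
InfWord = ℕ → Letter

factorAt : InfWord → ℕ → ℕ → Word
factorAt s i n = map (λ k → s (i + k)) (upTo n)

ComplexityIs : InfWord → ℕ → ℕ → Set
ComplexityIs s n m =
  Σ (List Word) λ F → Unique F × length F ≡ m ×
    (∀ w → (w ∈ F) ⇔ (∃[ i ] factorAt s i n ≡ w))

EventuallyPeriodic : InfWord → Set
EventuallyPeriodic s = Σ ℕ λ p → 1 ≤ p × Σ ℕ λ N → ∀ k → N ≤ k → s (k + p) ≡ s k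

Sturmian : InfWord → Set
Sturmian s = ¬ EventuallyPeriodic s × (∀ n → ComplexityIs s n (suc n))

FiniteSturmian : Word → Set
FiniteSturmian X = Σ InfWord λ s → Sturmian s × ∃[ i ] factorAt s i (length X) ≡ X

slice : ℕ → ℕ → Word → Word
slice i j X = take (j ∸ i) (drop i X)

Palindrome : Word → Set
Palindrome w = reverse w ≡ w

MaxPalOcc : Word → ℕ → ℕ → Set
MaxPalOcc X i j =
  i < j × j ≤ length X × Palindrome (slice i j X) ×
  ¬ (1 ≤ i × suc j ≤ length X × Palindrome (slice (i ∸ 1) (suc j) X))

centerStart : ℕ → ℕ → ℕ
centerStart i j = i + ((j ∸ i) ∸ 1) / 2

centerLen : ℕ → ℕ → ℕ
centerLen i j = 2 ∸ ((j ∸ i) % 2)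

centerWord : Word → ℕ → ℕ → Word
centerWord X i j = slice (centerStart i j) (centerStart i j + centerLen i j) X

IsCenterWord : Word → Set
IsCenterWord c = c ≡ a ∷ [] ⊎ c ≡ b ∷ [] ⊎ c ≡ a ∷ a ∷ []

Reflection : ℕ → ℕ → Word → Word → ℕ → ℕ → Set
Reflection p p' Y X i j =
  Σ Word λ t₁ → Σ Word λ l → Σ Word λ t₂ → Σ Word λ u → Σ Word λ v →
    Y ≡ t₁ ++ l ++ t₂ × IsCenterWord l ×
    α p p' l ≡ u ++ centerWord X i j ++ v ×
    take (centerStart i j) X ≡ α p p' t₁ ++ u ×
    drop (centerStart i j + centerLen i j) X ≡ v ++ α p p' t₂ ×
    suc (length u) ≡ length v

MaxOriginalPalOcc : ℕ → ℕ → Word → Word → ℕ → ℕ → Set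
MaxOriginalPalOcc p p' Y X i j =
  MaxPalOcc X i j × IsCenterWord (centerWord X i j) × ¬ Reflection p p' Y X i j

NumberOf : (ℕ → ℕ → Set) → ℕ → Set
NumberOf P N =
  Σ (List (ℕ × ℕ)) λ L → Unique L × length L ≡ N ×
    (∀ i j → ((i , j) ∈ L) ⇔ P i j)

module Submission where

-- Every occurrence of a, b or aa in X is the center of exactly one maximal palindrome, so maximal
-- palindromes are counted by centers, of which X has centerCount X = |X| + |X|_aa.  When X = α(Y),
-- the reflections are exactly the maximal palindromes centered at the center of b α(l) for an
-- occurrence of l ∈ {a, b, aa} in Y; these centers are distinct, so there are centerCount Y of them.
-- A block aᵠb of α(W) carries 2q centers, whence centerCount (α W) = 2 (p |W|_a + p′ |W|_b).  The
-- originals thus number 2 (pₓ |Y|_a + p′ₓ |Y|_b) − 2 |Y|_a, with |Y|_a = p_y |Z|_a + p′_y |Z|_b and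
-- |Y|_b = |Z|.

open import Data.List using (List; []; _∷_; _++_; _∷ʳ_; length; take; drop; reverse; map; replicate; filter)
open import Data.List.Membership.Propositional using (_∈_)
open import Data.List.Membership.Propositional.Properties using (∈-map⁺; ∈-map⁻; ∈-++⁺ˡ; ∈-++⁺ʳ; ∈-++⁻; ∈-filter⁺; ∈-filter⁻)
open import Data.List.Membership.Propositional.Properties.WithK using (unique∧set⇒bag)
open import Data.List.Properties using (length-++; length-map; length-replicate; length-take; length-drop; take++drop≡id; drop-drop; concatMap-++; ++-assoc; map-∘; map-id-local; ≡-dec; ∷-injective; ∷ʳ-injective; unfold-reverse; reverse-++)
open import Data.List.Relation.Binary.BagAndSetEquality using (∼bag⇒↭)
open import Data.List.Relation.Binary.Permutation.Propositional.Properties using (↭-length)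
open import Data.List.Relation.Binary.Subset.Propositional using (_⊆_)
open import Data.List.Relation.Unary.All using (All; []; _∷_; tabulate)
open import Data.List.Relation.Unary.Any using (here; there)
open import Data.List.Relation.Unary.Unique.Propositional using (Unique; []; _∷_)
open import Data.List.Relation.Unary.Unique.Propositional.Properties using (++⁺; map⁺; map⁻; filter⁺)
open import Data.Nat using (ℕ; zero; suc; _+_; _*_; _∸_; _⊓_; _≤_; _<_; _/_; _%_; z≤n; s≤s; _≤?_)
open import Data.Nat.DivMod using (m/n≡1+[m∸n]/n; [m+n]%n≡m%n; m%n<n; m/n≤m)
open import Data.Nat.ListAction using (sum)
open import Data.Nat.Properties
open import Data.Nat.Tactic.RingSolver using (solve-∀)
open import Data.Product using (Σ; ∃₂; ∃-syntax; _×_; _,_; proj₁; proj₂; uncurry)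
open import Data.Product.Properties using () renaming (≡-dec to ×-≡-dec)
open import Data.Sum using (_⊎_; inj₁; inj₂)
open import Defs
open import Function.Bundles using (_⇔_; mk⇔; Equivalence)
open import Relation.Binary.Definitions using (DecidableEquality; tri<; tri≈; tri>)
open import Relation.Binary.PropositionalEquality
open import Relation.Nullary using (¬_; Dec; yes; no; contradiction)
open import Relation.Nullary.Decidable using (_×-dec_)
open import Relation.Unary using (Pred)
import Relation.Unary as U
open import Relation.Unary.Properties using (∁?)

-- Centers

/2-suc-suc : ∀ m → suc (suc m) / 2 ≡ suc (m / 2)
/2-suc-suc m = m/n≡1+[m∸n]/n {suc (suc m)} {2} (s≤s (s≤s z≤n))

%2-suc-suc : ∀ m → suc (suc m) % 2 ≡ m % 2
%2-suc-suc m = trans (cong (_% 2) (+-comm 2 m)) ([m+n]%n≡m%n m 2)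

suc+suc : ∀ n → suc n + suc n ≡ suc (suc (n + n))
suc+suc n = cong suc (+-suc n n)

[n+n]/2≡n : ∀ n → (n + n) / 2 ≡ n
[n+n]/2≡n zero = refl
[n+n]/2≡n (suc n) = trans (cong (_/ 2) (suc+suc n)) (trans (/2-suc-suc (n + n)) (cong suc ([n+n]/2≡n n)))

[1+n+n]/2≡n : ∀ n → suc (n + n) / 2 ≡ n
[1+n+n]/2≡n zero = refl
[1+n+n]/2≡n (suc n) =
  trans (cong (λ m → suc m / 2) (suc+suc n)) (trans (/2-suc-suc (suc (n + n))) (cong suc ([1+n+n]/2≡n n)))

[n+n]%2≡0 : ∀ n → (n + n) % 2 ≡ 0
[n+n]%2≡0 zero = refl
[n+n]%2≡0 (suc n) = trans (cong (_% 2) (suc+suc n)) (trans (%2-suc-suc (n + n)) ([n+n]%2≡0 n))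

[1+n+n]%2≡1 : ∀ n → suc (n + n) % 2 ≡ 1
[1+n+n]%2≡1 zero = refl
[1+n+n]%2≡1 (suc n) =
  trans (cong (λ m → suc m % 2) (suc+suc n)) (trans (%2-suc-suc (suc (n + n))) ([1+n+n]%2≡1 n))

even-or-odd : ∀ n → ∃[ r ] (n ≡ r + r ⊎ n ≡ suc (r + r))
even-or-odd zero = 0 , inj₁ refl
even-or-odd (suc zero) = 0 , inj₂ refl
even-or-odd (suc (suc n)) with even-or-odd n
... | r , inj₁ refl = suc r , inj₁ (sym (suc+suc r))
... | r , inj₂ refl = suc r , inj₂ (cong suc (sym (suc+suc r)))

Center : Set
Center = ℕ × ℕ

centerOf : ℕ → ℕ → Center
centerOf i j = centerStart i j , centerLen i j

-- A palindrome of radius r about a center of length c has length r + r + c.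
CenterLength : ℕ → Set
CenterLength c = c ≡ 1 ⊎ c ≡ 2

1≤CenterLength : ∀ {c} → CenterLength c → 1 ≤ c
1≤CenterLength (inj₁ refl) = s≤s z≤n
1≤CenterLength (inj₂ refl) = s≤s z≤n

centerLen-CenterLength : ∀ i j → CenterLength (centerLen i j)
centerLen-CenterLength i j with (j ∸ i) % 2 | m%n<n (j ∸ i) 2
... | zero | _ = inj₂ refl
... | suc zero | _ = inj₁ refl
... | suc (suc _) | s≤s (s≤s ())

centerOf-radius : ∀ i r {c} → CenterLength c → centerOf i (i + (r + r + c)) ≡ (i + r , c)
centerOf-radius i r (inj₁ refl) rewrite m+n∸m≡n i (r + r + 1) | +-comm (r + r) 1
  = cong₂ _,_ (cong (i +_) ([n+n]/2≡n r)) (cong (2 ∸_) ([1+n+n]%2≡1 r))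
centerOf-radius i r (inj₂ refl) rewrite m+n∸m≡n i (r + r + 2) | +-comm (r + r) 2
  = cong₂ _,_ (cong (i +_) ([1+n+n]/2≡n r)) (cong (2 ∸_) (trans (%2-suc-suc (r + r)) ([n+n]%2≡0 r)))

span-extent : ∀ i r c → i + (r + r + c) ≡ i + r + c + r
span-extent = solve-∀

radius-decomposition : ∀ {i j} → i < j → ∃₂ λ r c → CenterLength c × j ≡ i + (r + r + c)
radius-decomposition {i} {j} i<j with even-or-odd (j ∸ i) | m+[n∸m]≡n (<⇒≤ i<j)
... | zero , inj₁ e | _ = contradiction e (m>n⇒m∸n≢0 i<j)
... | suc r , inj₁ e | j≡ =
  r , 2 , inj₂ refl , trans (sym j≡) (cong (i +_) (trans e (trans (suc+suc r) (+-comm 2 (r + r)))))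
... | r , inj₂ e | j≡ = r , 1 , inj₁ refl , trans (sym j≡) (cong (i +_) (trans e (+-comm 1 (r + r))))

centerOf₀ : ∀ {n} → 0 < n → ∃₂ λ r c → CenterLength c × n ≡ r + r + c × centerOf 0 n ≡ (r , c)
centerOf₀ 0<n with radius-decomposition 0<n
... | r , c , cl , refl = r , c , cl , refl , centerOf-radius 0 r cl

centerStart₀-< : ∀ {n} → 1 ≤ n → centerStart 0 n < n
centerStart₀-< {suc n} _ = s≤s (m/n≤m n 2)

module _ {A : Set} where

  take-suc-∷ʳ : ∀ m (xs : List A) → m < length xs → ∃[ y ] take (suc m) xs ≡ take m xs ∷ʳ y
  take-suc-∷ʳ zero (x ∷ xs) _ = x , refl
  take-suc-∷ʳ (suc m) (x ∷ xs) (s≤s m<n) with take-suc-∷ʳ m xs m<n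
  ... | y , eq = y , cong (x ∷_) eq

  take-drop-suc-suc : ∀ (xs : List A) i m → i + suc (suc m) ≤ length xs →
    ∃₂ λ x y → take (suc (suc m)) (drop i xs) ≡ x ∷ (take m (drop (suc i) xs) ∷ʳ y)
  take-drop-suc-suc (x ∷ xs) zero m (s≤s le) with take-suc-∷ʳ m xs le
  ... | y , eq = x , y , cong (x ∷_) eq
  take-drop-suc-suc (x ∷ xs) (suc i) m (s≤s le) = take-drop-suc-suc xs i m le

  take-++-≤ : ∀ n (xs ys : List A) → n ≤ length xs → take n (xs ++ ys) ≡ take n xs
  take-++-≤ zero xs ys _ = refl
  take-++-≤ (suc n) (x ∷ xs) ys (s≤s n≤) = cong (x ∷_) (take-++-≤ n xs ys n≤)

  drop-++-≤ : ∀ n (xs ys : List A) → n ≤ length xs → drop n (xs ++ ys) ≡ drop n xs ++ ys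
  drop-++-≤ zero xs ys _ = refl
  drop-++-≤ (suc n) (x ∷ xs) ys (s≤s n≤) = drop-++-≤ n xs ys n≤

  take-length-++ : ∀ (xs ys : List A) n → take (length xs + n) (xs ++ ys) ≡ xs ++ take n ys
  take-length-++ [] ys n = refl
  take-length-++ (x ∷ xs) ys n = cong (x ∷_) (take-length-++ xs ys n)

  drop-length-++ : ∀ (xs ys : List A) n → drop (length xs + n) (xs ++ ys) ≡ drop n ys
  drop-length-++ [] ys n = refl
  drop-length-++ (x ∷ xs) ys n = drop-length-++ xs ys n

  ≤-length-drop : ∀ n {m} (xs : List A) → n + m ≤ length xs → m ≤ length (drop n xs)
  ≤-length-drop n {m} xs le =
    subst (m ≤_) (sym (length-drop n xs)) (m+n≤o⇒m≤o∸n m (subst (_≤ length xs) (+-comm n m) le))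

  Palindrome-inner : ∀ x (w : List A) y → reverse (x ∷ (w ∷ʳ y)) ≡ x ∷ (w ∷ʳ y) → reverse w ≡ w
  Palindrome-inner x w y p = proj₁ (∷ʳ-injective (reverse w) w (proj₂ (∷-injective (trans (sym unfold) p))))
    where
    unfold : reverse (x ∷ (w ∷ʳ y)) ≡ y ∷ (reverse w ∷ʳ x)
    unfold = trans (unfold-reverse x (w ∷ʳ y)) (cong (_∷ʳ x) (reverse-++ w (y ∷ [])))

  take-drop-replicate : ∀ r c q (x : A) w → r + c ≤ q → take c (drop r (replicate q x ++ w)) ≡ replicate c x
  take-drop-replicate zero zero q x w _ = refl
  take-drop-replicate zero (suc c) (suc q) x w (s≤s le) = cong (x ∷_) (take-drop-replicate zero c q x w le)
  take-drop-replicate (suc r) c (suc q) x w (s≤s le) = take-drop-replicate r c q x w le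

  drop-replicate-++ : ∀ q (x : A) w → drop q (replicate q x ++ w) ≡ w
  drop-replicate-++ zero x w = refl
  drop-replicate-++ (suc q) x w = drop-replicate-++ q x w

length-filter+filter-∁ : ∀ {A : Set} {ℓ} {P : Pred A ℓ} (P? : U.Decidable P) (xs : List A) →
  length (filter P? xs) + length (filter (∁? P?) xs) ≡ length xs
length-filter+filter-∁ P? [] = refl
length-filter+filter-∁ P? (x ∷ xs) with P? x
... | yes _ = cong suc (length-filter+filter-∁ P? xs)
... | no _ = trans (+-suc _ _) (cong suc (length-filter+filter-∁ P? xs))

Unique-map-retraction : ∀ {A B : Set} (f : A → B) (g : B → A) {xs} → All (λ x → g (f x) ≡ x) xs →
  Unique xs → Unique (map f xs)
Unique-map-retraction f g {xs} g∘f≡id u =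
  map⁻ (subst Unique (sym (trans (sym (map-∘ {g = g} {f = f} xs)) (map-id-local g∘f≡id))) u)

module _ {A : Set} (_≟_ : DecidableEquality A) where
  open import Data.List.Membership.DecPropositional _≟_ using (_∈?_)

  length-filter-∈ : ∀ {xs ys : List A} → Unique xs → Unique ys → ys ⊆ xs →
    length (filter (_∈? ys) xs) ≡ length ys
  length-filter-∈ {xs} {ys} uxs uys ys⊆xs = ↭-length (∼bag⇒↭ (unique∧set⇒bag (filter⁺ (_∈? ys) uxs) uys
    (mk⇔ (λ v∈ → proj₂ (∈-filter⁻ (_∈? ys) {xs = xs} v∈))
         (λ v∈ → ∈-filter⁺ (_∈? ys) (ys⊆xs v∈) v∈))))

  length-filter-∉ : ∀ {xs ys : List A} → Unique xs → Unique ys → ys ⊆ xs →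
    length (filter (∁? (_∈? ys)) xs) + length ys ≡ length xs
  length-filter-∉ {xs} {ys} uxs uys ys⊆xs =
    trans (+-comm (length (filter (∁? (_∈? ys)) xs)) (length ys))
          (trans (cong (_+ length (filter (∁? (_∈? ys)) xs)) (sym (length-filter-∈ uxs uys ys⊆xs)))
                 (length-filter+filter-∁ (_∈? ys) xs))

-- Maximal palindromes

_≟ᴸ_ : DecidableEquality Letter
a ≟ᴸ a = yes refl
a ≟ᴸ b = no λ ()
b ≟ᴸ a = no λ ()
b ≟ᴸ b = yes refl

palindrome? : (w : Word) → Dec (Palindrome w)
palindrome? w = ≡-dec _≟ᴸ_ (reverse w) w

ball : Word → ℕ → ℕ → ℕ → Word
ball X s c r = take (r + r + c) (drop (s ∸ r) X)

ball-extent : ∀ s c r → r ≤ s → s + c + r ≡ (s ∸ r) + (r + r + c)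
ball-extent s c r r≤s = begin
  s + c + r                 ≡⟨ cong (λ t → t + c + r) (m∸n+n≡m r≤s) ⟨
  (s ∸ r) + r + c + r       ≡⟨ span-extent (s ∸ r) r c ⟨
  (s ∸ r) + (r + r + c)     ∎
  where open ≡-Reasoning

slice≡ball : ∀ X s c r → r ≤ s → slice (s ∸ r) (s + c + r) X ≡ ball X s c r
slice≡ball X s c r r≤s = cong (λ n → take n (drop (s ∸ r) X))
  (trans (cong (_∸ (s ∸ r)) (ball-extent s c r r≤s)) (m+n∸m≡n (s ∸ r) (r + r + c)))

slice≡ball-suc : ∀ X s c r → suc r ≤ s → slice ((s ∸ r) ∸ 1) (suc (s + c + r)) X ≡ ball X s c (suc r)
slice≡ball-suc X s c r r<s =
  trans (cong₂ (λ i j → slice i j X) (trans (∸-+-assoc s r 1) (cong (s ∸_) (+-comm r 1)))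
                                     (sym (+-suc (s + c) r)))
        (slice≡ball X s c (suc r) r<s)

ball-suc : ∀ X s c r → suc r ≤ s → s + c + suc r ≤ length X →
  ∃₂ λ x y → ball X s c (suc r) ≡ x ∷ (ball X s c r ∷ʳ y)
ball-suc X s c r r<s le with take-drop-suc-suc X (s ∸ suc r) (r + r + c) bound
  where
  bound : (s ∸ suc r) + suc (suc (r + r + c)) ≤ length X
  bound = ≤-trans (≤-reflexive (trans (cong ((s ∸ suc r) +_) (sym (cong (_+ c) (suc+suc r))))
                                      (sym (ball-extent s c (suc r) r<s)))) le
... | x , y , eq = x , y , trans (cong (λ n → take (n + c) (drop (s ∸ suc r) X)) (suc+suc r))
  (trans eq (cong (λ i → x ∷ (take (r + r + c) (drop i X) ∷ʳ y)) (sym (+-∸-assoc 1 r<s))))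

PalindromicRadius : Word → ℕ → ℕ → ℕ → Set
PalindromicRadius X s c r = r ≤ s × s + c + r ≤ length X × Palindrome (ball X s c r)

palindromicRadius? : ∀ X s c r → Dec (PalindromicRadius X s c r)
palindromicRadius? X s c r = (r ≤? s) ×-dec ((s + c + r ≤? length X) ×-dec palindrome? (ball X s c r))

PalindromicRadius-pred : ∀ X s c r → PalindromicRadius X s c (suc r) → PalindromicRadius X s c r
PalindromicRadius-pred X s c r (r<s , le , pal) with ball-suc X s c r r<s le
... | x , y , eq = <⇒≤ r<s , ≤-trans (+-monoʳ-≤ (s + c) (n≤1+n r)) le ,
                   Palindrome-inner x (ball X s c r) y (subst Palindrome eq pal)

PalindromicRadius-≤ : ∀ X s c {r k} → r ≤ k → PalindromicRadius X s c k → PalindromicRadius X s c r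
PalindromicRadius-≤ X s c {k = zero} z≤n pk = pk
PalindromicRadius-≤ X s c {r} {suc k} r≤k pk with m≤n⇒m<n∨m≡n r≤k
... | inj₂ refl = pk
... | inj₁ r<k = PalindromicRadius-≤ X s c (≤-pred r<k) (PalindromicRadius-pred X s c k pk)

-- 0 when no radius up to B is palindromic.
maxRadiusUpTo : Word → ℕ → ℕ → ℕ → ℕ
maxRadiusUpTo X s c zero = zero
maxRadiusUpTo X s c (suc B) with palindromicRadius? X s c (suc B)
... | yes _ = suc B
... | no _ = maxRadiusUpTo X s c B

maxRadiusUpTo-≤ : ∀ X s c B → maxRadiusUpTo X s c B ≤ B
maxRadiusUpTo-≤ X s c zero = z≤n
maxRadiusUpTo-≤ X s c (suc B) with palindromicRadius? X s c (suc B)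
... | yes _ = ≤-refl
... | no _ = m≤n⇒m≤1+n (maxRadiusUpTo-≤ X s c B)

maxRadiusUpTo-palindromic : ∀ X s c B → PalindromicRadius X s c 0 →
  PalindromicRadius X s c (maxRadiusUpTo X s c B)
maxRadiusUpTo-palindromic X s c zero p₀ = p₀
maxRadiusUpTo-palindromic X s c (suc B) p₀ with palindromicRadius? X s c (suc B)
... | yes p = p
... | no _ = maxRadiusUpTo-palindromic X s c B p₀

maxRadiusUpTo-maximal : ∀ X s c B {r} → maxRadiusUpTo X s c B < r → r ≤ B → ¬ PalindromicRadius X s c r
maxRadiusUpTo-maximal X s c zero lt z≤n = contradiction lt (λ ())
maxRadiusUpTo-maximal X s c (suc B) {r} lt r≤B p with palindromicRadius? X s c (suc B)
... | yes _ = <⇒≱ lt r≤B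
... | no ¬p with m≤n⇒m<n∨m≡n r≤B
...   | inj₂ refl = ¬p p
...   | inj₁ r<B = maxRadiusUpTo-maximal X s c B lt (≤-pred r<B) p

-- A palindromic radius never exceeds s, so searching up to s finds the largest one.
radius : Word → ℕ → ℕ → ℕ
radius X s c = maxRadiusUpTo X s c s

radius-unique : ∀ X s c r → PalindromicRadius X s c r → ¬ PalindromicRadius X s c (suc r) →
  radius X s c ≡ r
radius-unique X s c r pr ¬pr with <-cmp (radius X s c) r
... | tri≈ _ eq _ = eq
... | tri< lt _ _ = contradiction pr (maxRadiusUpTo-maximal X s c s lt (proj₁ pr))
... | tri> _ _ gt = contradiction
  (PalindromicRadius-≤ X s c gt (maxRadiusUpTo-palindromic X s c s (PalindromicRadius-≤ X s c z≤n pr))) ¬pr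

maxPalindrome : Word → Center → ℕ × ℕ
maxPalindrome X (s , c) = s ∸ radius X s c , s + c + radius X s c

IsCenter : Word → Center → Set
IsCenter X (s , c) = CenterLength c × s + c ≤ length X × IsCenterWord (take c (drop s X))

IsCenterWord⇒Palindrome : ∀ {w} → IsCenterWord w → Palindrome w
IsCenterWord⇒Palindrome (inj₁ refl) = refl
IsCenterWord⇒Palindrome (inj₂ (inj₁ refl)) = refl
IsCenterWord⇒Palindrome (inj₂ (inj₂ refl)) = refl

IsCenter⇒PalindromicRadius₀ : ∀ X s c → IsCenter X (s , c) → PalindromicRadius X s c 0
IsCenter⇒PalindromicRadius₀ X s c (_ , le , cw) =
  z≤n , subst (_≤ length X) (sym (+-identityʳ (s + c))) le , IsCenterWord⇒Palindrome cw

centerOf-maxPalindrome : ∀ X s c → CenterLength c → uncurry centerOf (maxPalindrome X (s , c)) ≡ (s , c)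
centerOf-maxPalindrome X s c cl = begin
  centerOf (s ∸ R) (s + c + R)                ≡⟨ cong (centerOf (s ∸ R)) (ball-extent s c R R≤s) ⟩
  centerOf (s ∸ R) ((s ∸ R) + (R + R + c))    ≡⟨ centerOf-radius (s ∸ R) R cl ⟩
  ((s ∸ R) + R , c)                           ≡⟨ cong (_, c) (m∸n+n≡m R≤s) ⟩
  (s , c)                                     ∎
  where
  open ≡-Reasoning
  R = radius X s c
  R≤s = maxRadiusUpTo-≤ X s c s

maxPalindrome-MaxPalOcc : ∀ X s c → IsCenter X (s , c) → uncurry (MaxPalOcc X) (maxPalindrome X (s , c))
maxPalindrome-MaxPalOcc X s c isC@(cl , _ , _) =
  i<j , j≤n , subst Palindrome (sym (slice≡ball X s c R R≤s)) pal , ¬extend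
  where
  R = radius X s c
  R≤s = maxRadiusUpTo-≤ X s c s
  pr = maxRadiusUpTo-palindromic X s c s (IsCenter⇒PalindromicRadius₀ X s c isC)
  j≤n = proj₁ (proj₂ pr)
  pal = proj₂ (proj₂ pr)
  i<j : s ∸ R < s + c + R
  i<j = ≤-trans (s≤s (m∸n≤m s R))
          (≤-trans (subst (_≤ s + c) (+-comm s 1) (+-monoʳ-≤ s (1≤CenterLength cl))) (m≤m+n (s + c) R))
  ¬extend : ¬ (1 ≤ s ∸ R × suc (s + c + R) ≤ length X ×
               Palindrome (slice ((s ∸ R) ∸ 1) (suc (s + c + R)) X))
  ¬extend (1≤i , le , p) = maxRadiusUpTo-maximal X s c s ≤-refl R<s
    (R<s , subst (_≤ length X) (sym (+-suc (s + c) R)) le , subst Palindrome (slice≡ball-suc X s c R R<s) p)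
    where
    R<s : suc R ≤ s
    R<s = m∸n≢0⇒n<m (λ eq → contradiction (subst (1 ≤_) eq 1≤i) λ ())

MaxPalOcc-radius : ∀ X i r c → MaxPalOcc X i (i + (r + r + c)) →
  PalindromicRadius X (i + r) c r × ¬ PalindromicRadius X (i + r) c (suc r)
MaxPalOcc-radius X i r c (_ , j≤n , pal , ¬extend) = pr , ¬pr
  where
  i≡ : i + r ∸ r ≡ i
  i≡ = m+n∸n≡m i r
  pr : PalindromicRadius X (i + r) c r
  pr = m≤n+m r i , subst (_≤ length X) (span-extent i r c) j≤n ,
       subst Palindrome (trans (cong₂ (λ i′ j′ → slice i′ j′ X) (sym i≡) (span-extent i r c))
                               (slice≡ball X (i + r) c r (m≤n+m r i))) pal
  ¬pr : ¬ PalindromicRadius X (i + r) c (suc r)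
  ¬pr (r<s , le , p) = ¬extend (subst (1 ≤_) i≡ (m<n⇒0<n∸m r<s) ,
    subst (_≤ length X) (trans (+-suc (i + r + c) r) (cong suc (sym (span-extent i r c)))) le ,
    subst Palindrome (sym (trans (cong₂ (λ i′ j′ → slice (i′ ∸ 1) (suc j′) X) (sym i≡) (span-extent i r c))
                                 (slice≡ball-suc X (i + r) c r r<s))) p)

maxPalindrome-centerOf : ∀ X i j → MaxPalOcc X i j → maxPalindrome X (centerOf i j) ≡ (i , j)
maxPalindrome-centerOf X i j mpo@(i<j , _) with radius-decomposition i<j
... | r , c , cl , refl with MaxPalOcc-radius X i r c mpo
... | pr , ¬pr = begin
  maxPalindrome X (centerOf i (i + (r + r + c)))
    ≡⟨ cong (maxPalindrome X) (centerOf-radius i r cl) ⟩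
  (i + r ∸ radius X (i + r) c , i + r + c + radius X (i + r) c)
    ≡⟨ cong (λ R → i + r ∸ R , i + r + c + R) (radius-unique X (i + r) c r pr ¬pr) ⟩
  (i + r ∸ r , i + r + c + r)
    ≡⟨ cong₂ _,_ (m+n∸n≡m i r) (sym (span-extent i r c)) ⟩
  (i , i + (r + r + c))
    ∎
  where open ≡-Reasoning

centerOf-within : ∀ {i j} → i < j → centerStart i j + centerLen i j ≤ j
centerOf-within {i} i<j with radius-decomposition i<j
... | r , c , cl , refl = begin
  centerStart i (i + (r + r + c)) + centerLen i (i + (r + r + c))
    ≡⟨ cong (uncurry _+_) (centerOf-radius i r cl) ⟩
  i + r + c         ≤⟨ m≤m+n (i + r + c) r ⟩
  i + r + c + r     ≡⟨ span-extent i r c ⟨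
  i + (r + r + c)   ∎
  where open ≤-Reasoning

centerWord≡ : ∀ X i j → centerWord X i j ≡ take (centerLen i j) (drop (centerStart i j) X)
centerWord≡ X i j =
  cong (λ n → take n (drop (centerStart i j) X)) (m+n∸m≡n (centerStart i j) (centerLen i j))

IsCenter-centerOf : ∀ X i j → MaxPalOcc X i j → IsCenterWord (centerWord X i j) → IsCenter X (centerOf i j)
IsCenter-centerOf X i j (i<j , j≤n , _) cw =
  centerLen-CenterLength i j , ≤-trans (centerOf-within i<j) j≤n ,
  subst IsCenterWord (centerWord≡ X i j) cw

-- Occurrences of a, b and aa

shift : ℕ → Center → Center
shift n (s , c) = n + s , c

shift-injective : ∀ n {k k′} → shift n k ≡ shift n k′ → k ≡ k′
shift-injective n {s , c} {s′ , c′} eq = cong₂ _,_ (+-cancelˡ-≡ n s s′ (cong proj₁ eq)) (cong proj₂ eq)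

centerWordPrefixes : Word → List Word
centerWordPrefixes (a ∷ a ∷ _) = (a ∷ []) ∷ (a ∷ a ∷ []) ∷ []
centerWordPrefixes (a ∷ b ∷ _) = (a ∷ []) ∷ []
centerWordPrefixes (a ∷ []) = (a ∷ []) ∷ []
centerWordPrefixes (b ∷ _) = (b ∷ []) ∷ []
centerWordPrefixes [] = []

∈-centerWordPrefixes⁺ : ∀ {l} t → IsCenterWord l → l ∈ centerWordPrefixes (l ++ t)
∈-centerWordPrefixes⁺ (a ∷ t) (inj₁ refl) = here refl
∈-centerWordPrefixes⁺ (b ∷ t) (inj₁ refl) = here refl
∈-centerWordPrefixes⁺ [] (inj₁ refl) = here refl
∈-centerWordPrefixes⁺ t (inj₂ (inj₁ refl)) = here refl
∈-centerWordPrefixes⁺ t (inj₂ (inj₂ refl)) = there (here refl)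

∈-centerWordPrefixes⁻ : ∀ w {l} → l ∈ centerWordPrefixes w → IsCenterWord l × ∃[ t ] w ≡ l ++ t
∈-centerWordPrefixes⁻ (a ∷ a ∷ w) (here refl) = inj₁ refl , a ∷ w , refl
∈-centerWordPrefixes⁻ (a ∷ a ∷ w) (there (here refl)) = inj₂ (inj₂ refl) , w , refl
∈-centerWordPrefixes⁻ (a ∷ b ∷ w) (here refl) = inj₁ refl , b ∷ w , refl
∈-centerWordPrefixes⁻ (a ∷ []) (here refl) = inj₁ refl , [] , refl
∈-centerWordPrefixes⁻ (b ∷ w) (here refl) = inj₂ (inj₁ refl) , w , refl

centerCount : Word → ℕ
centerCount [] = 0
centerCount (y ∷ W) = length (centerWordPrefixes (y ∷ W)) + centerCount W

-- One entry per occurrence of a center word l at W = t₁ l t₂: the center f l, moved by the offset of t₁.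
module Occurrences (δ : Letter → ℕ) (f : Word → Center) where

  offset : Word → ℕ
  offset t = sum (map δ t)

  occurrences : Word → List Center
  occurrences [] = []
  occurrences (y ∷ W) = map f (centerWordPrefixes (y ∷ W)) ++ map (shift (δ y)) (occurrences W)

  length-occurrences : ∀ W → length (occurrences W) ≡ centerCount W
  length-occurrences [] = refl
  length-occurrences (y ∷ W) = begin
    length (map f P ++ map (shift (δ y)) (occurrences W))
      ≡⟨ length-++ (map f P) ⟩
    length (map f P) + length (map (shift (δ y)) (occurrences W))
      ≡⟨ cong₂ _+_ (length-map f P) (length-map (shift (δ y)) (occurrences W)) ⟩
    length P + length (occurrences W)
      ≡⟨ cong (length P +_) (length-occurrences W) ⟩
    length P + centerCount W
      ∎
    where
    open ≡-Reasoning
    P = centerWordPrefixes (y ∷ W)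

  ∈-occurrences⁺ : ∀ t₁ {l} t₂ → IsCenterWord l →
    shift (offset t₁) (f l) ∈ occurrences (t₁ ++ l ++ t₂)
  ∈-occurrences⁺ [] t₂ cw@(inj₁ refl)        = ∈-++⁺ˡ (∈-map⁺ f (∈-centerWordPrefixes⁺ t₂ cw))
  ∈-occurrences⁺ [] t₂ cw@(inj₂ (inj₁ refl)) = ∈-++⁺ˡ (∈-map⁺ f (∈-centerWordPrefixes⁺ t₂ cw))
  ∈-occurrences⁺ [] t₂ cw@(inj₂ (inj₂ refl)) = ∈-++⁺ˡ (∈-map⁺ f (∈-centerWordPrefixes⁺ t₂ cw))
  ∈-occurrences⁺ (y ∷ t₁) {l} t₂ cw = ∈-++⁺ʳ (map f (centerWordPrefixes (y ∷ t₁ ++ l ++ t₂)))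
    (subst (_∈ map (shift (δ y)) (occurrences (t₁ ++ l ++ t₂)))
           (cong (_, proj₂ (f l)) (sym (+-assoc (δ y) (offset t₁) (proj₁ (f l)))))
           (∈-map⁺ (shift (δ y)) (∈-occurrences⁺ t₁ t₂ cw)))

  ∈-occurrences⁻ : ∀ W {k} → k ∈ occurrences W →
    Σ Word λ t₁ → Σ Word λ l → Σ Word λ t₂ →
      W ≡ t₁ ++ l ++ t₂ × IsCenterWord l × k ≡ shift (offset t₁) (f l)
  ∈-occurrences⁻ (y ∷ W) k∈ with ∈-++⁻ (map f (centerWordPrefixes (y ∷ W))) k∈
  ... | inj₁ k∈head with ∈-map⁻ f k∈head
  ...   | l , l∈ , refl with ∈-centerWordPrefixes⁻ (y ∷ W) l∈
  ...     | cw , t₂ , eq = [] , l , t₂ , eq , cw , refl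
  ∈-occurrences⁻ (y ∷ W) k∈ | inj₂ k∈tail with ∈-map⁻ (shift (δ y)) k∈tail
  ... | k′ , k′∈ , refl with ∈-occurrences⁻ W k′∈
  ...   | t₁ , l , t₂ , eq , cw , refl =
    y ∷ t₁ , l , t₂ , cong (y ∷_) eq , cw ,
    cong (_, proj₂ (f l)) (sym (+-assoc (δ y) (offset t₁) (proj₁ (f l))))

  occurrences-unique : f (a ∷ []) ≢ f (a ∷ a ∷ []) →
    (∀ {y w l} → l ∈ centerWordPrefixes (y ∷ w) → proj₁ (f l) < δ y) →
    ∀ W → Unique (occurrences W)
  occurrences-unique fa≢faa f<δ [] = []
  occurrences-unique fa≢faa f<δ (y ∷ W) =
    ++⁺ (head-unique (y ∷ W)) (map⁺ (shift-injective (δ y)) (occurrences-unique fa≢faa f<δ W)) disjoint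
    where
    head-unique : ∀ w → Unique (map f (centerWordPrefixes w))
    head-unique (a ∷ a ∷ _) = (fa≢faa ∷ []) ∷ [] ∷ []
    head-unique (a ∷ b ∷ _) = [] ∷ []
    head-unique (a ∷ []) = [] ∷ []
    head-unique (b ∷ _) = [] ∷ []
    head-unique [] = []
    disjoint : ∀ {k} → ¬ (k ∈ map f (centerWordPrefixes (y ∷ W)) × k ∈ map (shift (δ y)) (occurrences W))
    disjoint (k∈head , k∈tail) with ∈-map⁻ f k∈head | ∈-map⁻ (shift (δ y)) k∈tail
    ... | l , l∈ , refl | k′ , _ , eq =
      <⇒≱ (f<δ l∈) (subst (λ k → δ y ≤ proj₁ k) (sym eq) (m≤m+n (δ y) (proj₁ k′)))

IsCenter-++ʳ : ∀ W B {k} → IsCenter W k → IsCenter (W ++ B) k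
IsCenter-++ʳ W B {s , c} (cl , le , cw) =
  cl , ≤-trans le (≤-trans (m≤m+n (length W) (length B)) (≤-reflexive (sym (length-++ W)))) ,
  subst IsCenterWord (sym (trans (cong (take c) (drop-++-≤ s W B (≤-trans (m≤m+n s c) le)))
                                 (take-++-≤ c (drop s W) B (≤-length-drop s W le)))) cw

IsCenter-++ˡ : ∀ A W {k} → IsCenter W k → IsCenter (A ++ W) (shift (length A) k)
IsCenter-++ˡ A W {s , c} (cl , le , cw) =
  cl , subst (length A + s + c ≤_) (sym (length-++ A))
             (≤-trans (≤-reflexive (+-assoc (length A) s c)) (+-monoʳ-≤ (length A) le)) ,
  subst IsCenterWord (cong (take c) (sym (drop-length-++ A W s))) cw

IsCenter-++ : ∀ A W B {k} → IsCenter W k → IsCenter (A ++ W ++ B) (shift (length A) k)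
IsCenter-++ A W B isC = IsCenter-++ˡ A (W ++ B) (IsCenter-++ʳ W B isC)

IsCenter-centerWord : ∀ {l} → IsCenterWord l → IsCenter l (0 , length l)
IsCenter-centerWord (inj₁ refl) = inj₁ refl , ≤-refl , inj₁ refl
IsCenter-centerWord (inj₂ (inj₁ refl)) = inj₁ refl , ≤-refl , inj₂ (inj₁ refl)
IsCenter-centerWord (inj₂ (inj₂ refl)) = inj₂ refl , ≤-refl , inj₂ (inj₂ refl)

module Centers = Occurrences (λ _ → 1) (λ l → 0 , length l)

centers : Word → List Center
centers = Centers.occurrences

offset-length : ∀ t → Centers.offset t ≡ length t
offset-length [] = refl
offset-length (_ ∷ t) = cong suc (offset-length t)

∈-centers⁻ : ∀ X {k} → k ∈ centers X → IsCenter X k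
∈-centers⁻ X k∈ with Centers.∈-occurrences⁻ X k∈
... | t₁ , l , t₂ , refl , cw , refl =
  subst (IsCenter (t₁ ++ l ++ t₂)) (cong (λ n → n + 0 , length l) (sym (offset-length t₁)))
        (IsCenter-++ t₁ l t₂ (IsCenter-centerWord cw))

∈-centers⁺ : ∀ X {k} → IsCenter X k → k ∈ centers X
∈-centers⁺ X {s , c} (cl , le , cw) =
  subst₂ (λ k W → k ∈ centers W) k≡ X≡ (Centers.∈-occurrences⁺ (take s X) (drop c (drop s X)) cw)
  where
  s≤ : s ≤ length X
  s≤ = ≤-trans (m≤m+n s c) le
  c≤ : c ≤ length (drop s X)
  c≤ = ≤-length-drop s X le
  X≡ : take s X ++ take c (drop s X) ++ drop c (drop s X) ≡ X
  X≡ = trans (cong (take s X ++_) (take++drop≡id c (drop s X))) (take++drop≡id s X)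
  k≡ : (Centers.offset (take s X) + 0 , length (take c (drop s X))) ≡ (s , c)
  k≡ = cong₂ _,_ (trans (+-identityʳ _)
                        (trans (offset-length (take s X)) (trans (length-take s X) (m≤n⇒m⊓n≡m s≤))))
                 (trans (length-take c (drop s X)) (m≤n⇒m⊓n≡m c≤))

centers-unique : ∀ X → Unique (centers X)
centers-unique = Centers.occurrences-unique (λ ()) (λ _ → s≤s z≤n)

length-centers : ∀ X → length (centers X) ≡ centerCount X
length-centers = Centers.length-occurrences

-- Each a of the block aᵠb is a center, as is each of its q − 1 factors aa and the closing b.
centerCount-block : ∀ q R → 1 ≤ q → centerCount (replicate q a ++ b ∷ R) ≡ q + q + centerCount R
centerCount-block (suc zero) R _ = refl
centerCount-block (suc (suc q)) R _ = begin
  2 + centerCount (replicate (suc q) a ++ b ∷ R)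
    ≡⟨ cong (2 +_) (centerCount-block (suc q) R (s≤s z≤n)) ⟩
  2 + (suc q + suc q + centerCount R)
    ≡⟨ cong (λ n → suc (suc (n + centerCount R))) (+-suc q (suc q)) ⟨
  suc (suc q) + suc (suc q) + centerCount R
    ∎
  where open ≡-Reasoning

-- The morphism α

count-block-a : ∀ q R → count a (replicate q a ++ b ∷ R) ≡ q + count a R
count-block-a zero R = refl
count-block-a (suc q) R = cong suc (count-block-a q R)

count-block-b : ∀ q R → count b (replicate q a ++ b ∷ R) ≡ suc (count b R)
count-block-b zero R = refl
count-block-b (suc q) R = count-block-b q R

IsCenterWord-replicate : ∀ {c} → CenterLength c → IsCenterWord (replicate c a)
IsCenterWord-replicate (inj₁ refl) = inj₁ refl
IsCenterWord-replicate (inj₂ refl) = inj₂ (inj₂ refl)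

split-around : ∀ (T₁ L T₂ : Word) r c → length L ≡ suc (r + r + c) →
  let X = T₁ ++ L ++ T₂ ; s = length T₁ + r in
  L ≡ take r L ++ slice s (s + c) X ++ drop c (drop r L) ×
  take s X ≡ T₁ ++ take r L ×
  drop (s + c) X ≡ drop c (drop r L) ++ T₂ ×
  suc (length (take r L)) ≡ length (drop c (drop r L))
split-around T₁ L T₂ r c len = L≡ , take≡ , drop≡ , length≡
  where
  X = T₁ ++ L ++ T₂
  s = length T₁ + r
  rc≤ : r + c ≤ length L
  rc≤ = subst (r + c ≤_) (sym len) (≤-trans (+-monoˡ-≤ c (m≤n+m r r)) (n≤1+n (r + r + c)))
  r≤ : r ≤ length L
  r≤ = ≤-trans (m≤m+n r c) rc≤
  drop-s : drop s X ≡ drop r L ++ T₂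
  drop-s = trans (drop-length-++ T₁ (L ++ T₂) r) (drop-++-≤ r L T₂ r≤)
  slice≡ : slice s (s + c) X ≡ take c (drop r L)
  slice≡ = trans (cong (λ n → take n (drop s X)) (m+n∸m≡n s c))
                 (trans (cong (take c) drop-s) (take-++-≤ c (drop r L) T₂ (≤-length-drop r L rc≤)))
  L≡ : L ≡ take r L ++ slice s (s + c) X ++ drop c (drop r L)
  L≡ = trans (sym (take++drop≡id r L))
             (cong (take r L ++_) (trans (sym (take++drop≡id c (drop r L)))
                                         (cong (_++ drop c (drop r L)) (sym slice≡))))
  take≡ : take s X ≡ T₁ ++ take r L
  take≡ = trans (take-length-++ T₁ (L ++ T₂) r) (cong (T₁ ++_) (take-++-≤ r L T₂ r≤))
  drop≡ : drop (s + c) X ≡ drop c (drop r L) ++ T₂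
  drop≡ = trans (sym (drop-drop s c X))
                (trans (cong (drop c) drop-s) (drop-++-≤ c (drop r L) T₂ (≤-length-drop r L rc≤)))
  length≡ : suc (length (take r L)) ≡ length (drop c (drop r L))
  length≡ = begin
    suc (length (take r L))          ≡⟨ cong suc (trans (length-take r L) (m≤n⇒m⊓n≡m r≤)) ⟩
    suc r                            ≡⟨ m+n∸n≡m (suc r) c ⟨
    suc r + c ∸ c                    ≡⟨ cong (_∸ c) (m+n∸n≡m (suc r + c) r) ⟨
    suc r + c + r ∸ r ∸ c            ≡⟨ cong (λ n → n ∸ r ∸ c) (rearrange r c) ⟩
    suc (r + r + c) ∸ r ∸ c          ≡⟨ cong (λ n → n ∸ r ∸ c) len ⟨
    length L ∸ r ∸ c                 ≡⟨ cong (_∸ c) (length-drop r L) ⟨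
    length (drop r L) ∸ c            ≡⟨ length-drop c (drop r L) ⟨
    length (drop c (drop r L))       ∎
    where
    open ≡-Reasoning
    rearrange : ∀ r c → suc r + c + r ≡ suc (r + r + c)
    rearrange = solve-∀

module Morphism (p p′ : ℕ) (1≤p : 1 ≤ p) (1≤p′ : 1 ≤ p′) where

  power : Letter → ℕ
  power a = p
  power b = p′

  1≤power : ∀ y → 1 ≤ power y
  1≤power a = 1≤p
  1≤power b = 1≤p′

  α-∷ : ∀ y W → α p p′ (y ∷ W) ≡ replicate (power y) a ++ b ∷ α p p′ W
  α-∷ a W = ++-assoc (replicate p a) (b ∷ []) (α p p′ W)
  α-∷ b W = ++-assoc (replicate p′ a) (b ∷ []) (α p p′ W)

  α-++ : ∀ A B → α p p′ (A ++ B) ≡ α p p′ A ++ α p p′ B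
  α-++ = concatMap-++ (αimg p p′)

  length-αimg : ∀ y → length (αimg p p′ y) ≡ suc (power y)
  length-αimg a = trans (length-++ (replicate p a)) (trans (cong (_+ 1) (length-replicate p)) (+-comm p 1))
  length-αimg b = trans (length-++ (replicate p′ a)) (trans (cong (_+ 1) (length-replicate p′)) (+-comm p′ 1))

  power-step : ∀ y W →
    power y + (p * count a W + p′ * count b W) ≡ p * count a (y ∷ W) + p′ * count b (y ∷ W)
  power-step a W = step p p′ (count a W) (count b W)
    where
    step : ∀ p p′ A B → p + (p * A + p′ * B) ≡ p * suc A + p′ * B
    step = solve-∀
  power-step b W = step p p′ (count a W) (count b W)
    where
    step : ∀ p p′ A B → p′ + (p * A + p′ * B) ≡ p * A + p′ * suc B
    step = solve-∀

  count-α-a : ∀ W → count a (α p p′ W) ≡ p * count a W + p′ * count b W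
  count-α-a [] = sym (cong₂ _+_ (*-zeroʳ p) (*-zeroʳ p′))
  count-α-a (y ∷ W) = begin
    count a (α p p′ (y ∷ W))                    ≡⟨ cong (count a) (α-∷ y W) ⟩
    count a (replicate (power y) a ++ b ∷ α p p′ W)
                                                ≡⟨ count-block-a (power y) (α p p′ W) ⟩
    power y + count a (α p p′ W)                ≡⟨ cong (power y +_) (count-α-a W) ⟩
    power y + (p * count a W + p′ * count b W)  ≡⟨ power-step y W ⟩
    p * count a (y ∷ W) + p′ * count b (y ∷ W)  ∎
    where open ≡-Reasoning

  count-α-b : ∀ W → count b (α p p′ W) ≡ length W
  count-α-b [] = refl
  count-α-b (y ∷ W) =
    trans (cong (count b) (α-∷ y W)) (trans (count-block-b (power y) (α p p′ W)) (cong suc (count-α-b W)))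

  centerCount-α : ∀ W → centerCount (α p p′ W) ≡ 2 * (p * count a W + p′ * count b W)
  centerCount-α [] = cong (2 *_) (sym (cong₂ _+_ (*-zeroʳ p) (*-zeroʳ p′)))
  centerCount-α (y ∷ W) = begin
    centerCount (α p p′ (y ∷ W))
      ≡⟨ cong centerCount (α-∷ y W) ⟩
    centerCount (replicate (power y) a ++ b ∷ α p p′ W)
      ≡⟨ centerCount-block (power y) (α p p′ W) (1≤power y) ⟩
    power y + power y + centerCount (α p p′ W)
      ≡⟨ cong (power y + power y +_) (centerCount-α W) ⟩
    power y + power y + 2 * (p * count a W + p′ * count b W)
      ≡⟨ double (power y) (p * count a W + p′ * count b W) ⟩
    2 * (power y + (p * count a W + p′ * count b W))
      ≡⟨ cong (2 *_) (power-step y W) ⟩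
    2 * (p * count a (y ∷ W) + p′ * count b (y ∷ W))
      ∎
    where
    open ≡-Reasoning
    double : ∀ m n → m + m + 2 * n ≡ 2 * (m + n)
    double = solve-∀

  length-α-letter : ∀ y → length (α p p′ (y ∷ [])) ≡ suc (power y)
  length-α-letter y = trans (length-++ (αimg p p′ y)) (trans (+-identityʳ _) (length-αimg y))

  length-α-aa : length (α p p′ (a ∷ a ∷ [])) ≡ suc (p + p + 1)
  length-α-aa = trans (length-++ (αimg p p′ a)) (trans (cong₂ _+_ (length-αimg a) (length-α-letter a))
                  (cong suc (trans (+-suc p p) (+-comm 1 (p + p)))))

  -- α(l) = w b, so the palindrome b α(l) = b w b has the center of w, which occupies [0 , |α(l)| − 1).
  reflectionCenter : Word → Center
  reflectionCenter l = centerOf 0 (length (α p p′ l) ∸ 1)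

  reflectionCenter-letter : ∀ y → reflectionCenter (y ∷ []) ≡ centerOf 0 (power y)
  reflectionCenter-letter y = cong (λ n → centerOf 0 (n ∸ 1)) (length-α-letter y)

  reflectionCenter-radius : ∀ l r {c} → CenterLength c → length (α p p′ l) ≡ suc (r + r + c) →
    reflectionCenter l ≡ (r , c)
  reflectionCenter-radius l r cl len = trans (cong (λ n → centerOf 0 (n ∸ 1)) len) (centerOf-radius 0 r cl)

  reflectionCenter-aa : reflectionCenter (a ∷ a ∷ []) ≡ (p , 1)
  reflectionCenter-aa = reflectionCenter-radius (a ∷ a ∷ []) p (inj₁ refl) length-α-aa

  length-α-centerWord : ∀ {l} → IsCenterWord l → ∃[ n ] 0 < n × length (α p p′ l) ≡ suc n
  length-α-centerWord (inj₁ refl) = p , 1≤p , length-α-letter a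
  length-α-centerWord (inj₂ (inj₁ refl)) = p′ , 1≤p′ , length-α-letter b
  length-α-centerWord (inj₂ (inj₂ refl)) = p + p + 1 , m≤n+m 1 (p + p) , length-α-aa

  reflectionCenter-spec : ∀ {l} → IsCenterWord l →
    ∃₂ λ r c → CenterLength c × length (α p p′ l) ≡ suc (r + r + c) × reflectionCenter l ≡ (r , c)
  reflectionCenter-spec cw with length-α-centerWord cw
  ... | n , 0<n , len with centerOf₀ 0<n
  ...   | r , c , cl , refl , center = r , c , cl , len , trans (cong (λ m → centerOf 0 (m ∸ 1)) len) center

  IsCenter-reflectionCenter : ∀ {l} → IsCenterWord l → IsCenter (α p p′ l) (reflectionCenter l)
  IsCenter-reflectionCenter {a ∷ a ∷ []} (inj₂ (inj₂ refl)) =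
    subst (IsCenter (α p p′ (a ∷ a ∷ []))) (sym reflectionCenter-aa)
    (inj₁ refl ,
     subst (p + 1 ≤_) (sym length-α-aa) (≤-trans (≤-reflexive (+-comm p 1)) (s≤s (≤-trans (m≤m+n p p) (m≤m+n (p + p) 1)))) ,
     subst IsCenterWord (sym (trans (cong (λ X → take 1 (drop p X)) (α-∷ a (a ∷ [])))
                                    (cong (take 1) (drop-replicate-++ p a (b ∷ α p p′ (a ∷ []))))))
           (inj₂ (inj₁ refl)))
  IsCenter-reflectionCenter {y ∷ []} cw with reflectionCenter-spec cw
  ... | r , c , cl , len , center = subst (IsCenter (α p p′ (y ∷ []))) (sym center)
    (cl , subst (r + c ≤_) (sym len) (≤-trans (+-monoˡ-≤ c (m≤n+m r r)) (n≤1+n (r + r + c))) ,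
     subst IsCenterWord (sym (trans (cong (λ X → take c (drop r X)) (α-∷ y []))
                                    (take-drop-replicate r c (power y) a (b ∷ []) rc≤q)))
           (IsCenterWord-replicate cl))
    where
    rc≤q : r + c ≤ power y
    rc≤q = subst (r + c ≤_) (suc-injective (trans (sym len) (length-α-letter y))) (+-monoˡ-≤ c (m≤n+m r r))

  module Reflections = Occurrences (λ y → length (αimg p p′ y)) reflectionCenter

  reflectionCenters : Word → List Center
  reflectionCenters = Reflections.occurrences

  offset-α : ∀ t → Reflections.offset t ≡ length (α p p′ t)
  offset-α [] = refl
  offset-α (y ∷ t) = trans (cong (length (αimg p p′ y) +_) (offset-α t)) (sym (length-++ (αimg p p′ y)))

  length-reflectionCenters : ∀ Y → length (reflectionCenters Y) ≡ centerCount Y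
  length-reflectionCenters = Reflections.length-occurrences

  reflectionCenters-unique : ∀ Y → Unique (reflectionCenters Y)
  reflectionCenters-unique = Reflections.occurrences-unique a≢aa below-block
    where
    a≢aa : reflectionCenter (a ∷ []) ≢ reflectionCenter (a ∷ a ∷ [])
    a≢aa eq = <⇒≢ (centerStart₀-< 1≤p)
                   (cong proj₁ (trans (sym (reflectionCenter-letter a)) (trans eq reflectionCenter-aa)))
    letter : ∀ y → proj₁ (reflectionCenter (y ∷ [])) < length (αimg p p′ y)
    letter y = subst₂ (λ k n → proj₁ k < n) (sym (reflectionCenter-letter y)) (sym (length-αimg y))
                      (≤-trans (centerStart₀-< (1≤power y)) (n≤1+n (power y)))
    below-block : ∀ {y w l} → l ∈ centerWordPrefixes (y ∷ w) →
      proj₁ (reflectionCenter l) < length (αimg p p′ y)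
    below-block {a} {a ∷ _} (here refl) = letter a
    below-block {a} {a ∷ _} (there (here refl)) =
      subst₂ (λ k n → proj₁ k < n) (sym reflectionCenter-aa) (sym (length-αimg a)) ≤-refl
    below-block {a} {b ∷ _} (here refl) = letter a
    below-block {a} {[]} (here refl) = letter a
    below-block {b} (here refl) = letter b

  α-split : ∀ t₁ l t₂ → α p p′ (t₁ ++ l ++ t₂) ≡ α p p′ t₁ ++ α p p′ l ++ α p p′ t₂
  α-split t₁ l t₂ = trans (α-++ t₁ (l ++ t₂)) (cong (α p p′ t₁ ++_) (α-++ l t₂))

  reflectionCenters⊆centers : ∀ Y {k} → k ∈ reflectionCenters Y → k ∈ centers (α p p′ Y)
  reflectionCenters⊆centers Y k∈ with Reflections.∈-occurrences⁻ Y k∈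
  ... | t₁ , l , t₂ , refl , cw , refl = ∈-centers⁺ (α p p′ (t₁ ++ l ++ t₂))
    (subst₂ IsCenter (sym (α-split t₁ l t₂)) (cong (λ n → shift n (reflectionCenter l)) (sym (offset-α t₁)))
            (IsCenter-++ (α p p′ t₁) (α p p′ l) (α p p′ t₂) (IsCenter-reflectionCenter cw)))

  -- Reflection p p′ Y X i j unfolds to ReflectionAt Y X (centerOf i j).
  ReflectionAt : Word → Word → Center → Set
  ReflectionAt Y X (s , c) =
    Σ Word λ t₁ → Σ Word λ l → Σ Word λ t₂ → Σ Word λ u → Σ Word λ v →
      Y ≡ t₁ ++ l ++ t₂ × IsCenterWord l ×
      α p p′ l ≡ u ++ slice s (s + c) X ++ v ×
      take s X ≡ α p p′ t₁ ++ u ×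
      drop (s + c) X ≡ v ++ α p p′ t₂ ×
      suc (length u) ≡ length v

  ∈⇒ReflectionAt : ∀ Y {k} → k ∈ reflectionCenters Y → ReflectionAt Y (α p p′ Y) k
  ∈⇒ReflectionAt Y k∈ with Reflections.∈-occurrences⁻ Y k∈
  ... | t₁ , l , t₂ , refl , cw , refl with reflectionCenter-spec cw
  ... | r , c , _ , len , center with split-around (α p p′ t₁) (α p p′ l) (α p p′ t₂) r c len
  ... | L≡ , take≡ , drop≡ , length≡ =
    subst₂ (ReflectionAt (t₁ ++ l ++ t₂)) (sym (α-split t₁ l t₂)) (cong₂ shift (sym (offset-α t₁)) (sym center))
      (t₁ , l , t₂ , take r (α p p′ l) , drop c (drop r (α p p′ l)) ,
       refl , cw , L≡ , take≡ , drop≡ , length≡)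

  ReflectionAt⇒∈ : ∀ Y s {c} → CenterLength c → ReflectionAt Y (α p p′ Y) (s , c) →
    (s , c) ∈ reflectionCenters Y
  ReflectionAt⇒∈ Y s {c} cl (t₁ , l , t₂ , u , v , refl , cw , L≡ , take≡ , drop≡ , length≡) =
    subst (_∈ reflectionCenters (t₁ ++ l ++ t₂)) center (Reflections.∈-occurrences⁺ t₁ t₂ cw)
    where
    X = α p p′ (t₁ ++ l ++ t₂)
    sc<X : s + c < length X
    sc<X = m∸n≢0⇒n<m λ eq → contradiction (trans (sym eq) rest) λ ()
      where
      rest : length X ∸ (s + c) ≡ suc (length u) + length (α p p′ t₂)
      rest = trans (sym (length-drop (s + c) X))
                   (trans (cong length drop≡)
                          (trans (length-++ v) (cong (_+ length (α p p′ t₂)) (sym length≡))))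
    s≡ : s ≡ length (α p p′ t₁) + length u
    s≡ = trans (sym (m≤n⇒m⊓n≡m (≤-trans (m≤m+n s c) (<⇒≤ sc<X))))
               (trans (sym (length-take s X)) (trans (cong length take≡) (length-++ (α p p′ t₁))))
    slice-length : length (slice s (s + c) X) ≡ c
    slice-length = trans (length-take (s + c ∸ s) (drop s X))
                         (trans (cong (_⊓ length (drop s X)) (m+n∸m≡n s c))
                                (m≤n⇒m⊓n≡m (≤-length-drop s X (<⇒≤ sc<X))))
    αl-length : length (α p p′ l) ≡ suc (length u + length u + c)
    αl-length = begin
      length (α p p′ l)
        ≡⟨ cong length L≡ ⟩
      length (u ++ slice s (s + c) X ++ v)
        ≡⟨ length-++ u ⟩
      length u + length (slice s (s + c) X ++ v)
        ≡⟨ cong (length u +_) (length-++ (slice s (s + c) X)) ⟩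
      length u + (length (slice s (s + c) X) + length v)
        ≡⟨ cong₂ (λ m n → length u + (m + n)) slice-length (sym length≡) ⟩
      length u + (c + suc (length u))
        ≡⟨ rearrange (length u) c ⟩
      suc (length u + length u + c)
        ∎
      where
      open ≡-Reasoning
      rearrange : ∀ u c → u + (c + suc u) ≡ suc (u + u + c)
      rearrange = solve-∀
    center : shift (Reflections.offset t₁) (reflectionCenter l) ≡ (s , c)
    center = trans (cong₂ shift (offset-α t₁) (reflectionCenter-radius l (length u) cl αl-length))
                   (cong (_, c) (sym s≡))

  Reflection⇔∈ : ∀ Y i j → Reflection p p′ Y (α p p′ Y) i j ⇔ centerOf i j ∈ reflectionCenters Y
  Reflection⇔∈ Y i j =
    mk⇔ (ReflectionAt⇒∈ Y (centerStart i j) (centerLen-CenterLength i j)) (∈⇒ReflectionAt Y)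

-- maxPalindrome X and centerOf are inverse bijections between centers and maximal palindrome occurrences.
NumberOf-maxPalindromes : ∀ X (R : List Center) (Excluded : ℕ → ℕ → Set) →
  Unique R → R ⊆ centers X → (∀ i j → Excluded i j ⇔ centerOf i j ∈ R) →
  ∀ N → N + length R ≡ centerCount X →
  NumberOf (λ i j → MaxPalOcc X i j × IsCenterWord (centerWord X i j) × ¬ Excluded i j) N
NumberOf-maxPalindromes X R Excluded uR R⊆C excluded⇔ N N+R≡ =
  L , uL , lenL , λ i j → mk⇔ (to i j) (from i j)
  where
  _≟ᶜ_ : DecidableEquality Center
  _≟ᶜ_ = ×-≡-dec _≟_ _≟_
  open import Data.List.Membership.DecPropositional _≟ᶜ_ using (_∈?_)
  K = filter (∁? (_∈? R)) (centers X)
  L = map (maxPalindrome X) K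
  ∈K⁻ : ∀ {k} → k ∈ K → k ∈ centers X × ¬ k ∈ R
  ∈K⁻ = ∈-filter⁻ (∁? (_∈? R)) {xs = centers X}
  uL : Unique L
  uL = Unique-map-retraction (maxPalindrome X) (uncurry centerOf)
         (tabulate λ { {s , c} k∈ → centerOf-maxPalindrome X s c (proj₁ (∈-centers⁻ X (proj₁ (∈K⁻ k∈)))) })
         (filter⁺ (∁? (_∈? R)) (centers-unique X))
  lenL : length L ≡ N
  lenL = trans (length-map (maxPalindrome X) K)
           (+-cancelʳ-≡ _ _ _ (trans (length-filter-∉ _≟ᶜ_ (centers-unique X) uR R⊆C)
                                     (trans (length-centers X) (sym N+R≡))))
  to : ∀ i j → (i , j) ∈ L → MaxPalOcc X i j × IsCenterWord (centerWord X i j) × ¬ Excluded i j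
  to i j ij∈ with ∈-map⁻ (maxPalindrome X) ij∈
  ... | (s , c) , k∈ , refl = maxPalindrome-MaxPalOcc X s c isC , cw ,
    λ exc → proj₂ (∈K⁻ k∈) (subst (_∈ R) center (Equivalence.to (excluded⇔ i′ j′) exc))
    where
    i′ = s ∸ radius X s c
    j′ = s + c + radius X s c
    isC = ∈-centers⁻ X (proj₁ (∈K⁻ k∈))
    center = centerOf-maxPalindrome X s c (proj₁ isC)
    cw = subst IsCenterWord (sym (trans (centerWord≡ X i′ j′) (cong (λ k → take (proj₂ k) (drop (proj₁ k) X)) center)))
               (proj₂ (proj₂ isC))
  from : ∀ i j → MaxPalOcc X i j × IsCenterWord (centerWord X i j) × ¬ Excluded i j → (i , j) ∈ L
  from i j (mpo , cw , ¬exc) = subst (_∈ L) (maxPalindrome-centerOf X i j mpo)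
    (∈-map⁺ (maxPalindrome X) (∈-filter⁺ (∁? (_∈? R)) (∈-centers⁺ X (IsCenter-centerOf X i j mpo cw))
                                                     (λ k∈R → ¬exc (Equivalence.from (excluded⇔ i j) k∈R))))

centerCount-α∘α : ∀ px px′ py py′ → 1 ≤ px → 1 ≤ px′ → 1 ≤ py → 1 ≤ py′ → ∀ Z →
  2 * (px ∸ 1) * (count a Z * py + count b Z * py′) + 2 * length Z * px′ + centerCount (α py py′ Z)
    ≡ centerCount (α px px′ (α py py′ Z))
centerCount-α∘α px@(suc x) px′ py py′ 1≤px 1≤px′ 1≤py 1≤py′ Z = begin
  2 * x * (za * py + zb * py′) + 2 * n * px′ + centerCount (α py py′ Z)
    ≡⟨ cong (2 * x * (za * py + zb * py′) + 2 * n * px′ +_) (OfZ.centerCount-α Z) ⟩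
  2 * x * (za * py + zb * py′) + 2 * n * px′ + 2 * (py * za + py′ * zb)
    ≡⟨ identity x px′ py py′ za zb n ⟩
  2 * (px * (py * za + py′ * zb) + px′ * n)
    ≡⟨ cong₂ (λ A B → 2 * (px * A + px′ * B)) (OfZ.count-α-a Z) (OfZ.count-α-b Z) ⟨
  2 * (px * count a (α py py′ Z) + px′ * count b (α py py′ Z))
    ≡⟨ OfY.centerCount-α (α py py′ Z) ⟨
  centerCount (α px px′ (α py py′ Z))
    ∎
  where
  open ≡-Reasoning
  module OfY = Morphism px px′ 1≤px 1≤px′
  module OfZ = Morphism py py′ 1≤py 1≤py′
  za = count a Z
  zb = count b Z
  n = length Z
  identity : ∀ x px′ py py′ za zb n →
    2 * x * (za * py + zb * py′) + 2 * n * px′ + 2 * (py * za + py′ * zb) ≡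
    2 * (suc x * (py * za + py′ * zb) + px′ * n)
  identity = solve-∀

lemma3 : (px px' py py' : ℕ) → ValidPair px px' → ValidPair py py' →
    (Z Y X : Word) → Y ≡ α py py' Z → X ≡ α px px' Y → FiniteSturmian X →
    NumberOf (MaxOriginalPalOcc px px' Y X)
      (2 * (px ∸ 1) * (count a Z * py + count b Z * py') + 2 * length Z * px')
lemma3 px px′ py py′ (1≤px , 1≤px′ , _) (1≤py , 1≤py′ , _) Z Y X refl refl _ =
  NumberOf-maxPalindromes X (reflectionCenters Y) (Reflection px px′ Y X)
    (reflectionCenters-unique Y) (reflectionCenters⊆centers Y) (Reflection⇔∈ Y) N
    (trans (cong (N +_) (length-reflectionCenters Y)) (centerCount-α∘α px px′ py py′ 1≤px 1≤px′ 1≤py 1≤py′ Z))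
  where
  open Morphism px px′ 1≤px 1≤px′
  N = 2 * (px ∸ 1) * (count a Z * py + count b Z * py′) + 2 * length Z * px′
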